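{- Let $N\ge0$, $k\ge1$, $X=\{0,\ldots,N\}^k$. Let $\mathcal A$ be any deterministic algorithm that accesses a feasibility function $f$ on $X$ only through oracle calls (queries of $f(\vec x)$ for chosen $\vec x\in X$) and that, for every feasibility function $f$ on $X$, terminates and outputs exactly the set of Pareto points of $f$. Then for every feasibility function $f$ on $X$, the run of $\mathcal A$ on $f$ queries $f$ at every co-Pareto point of $f$.
   Context: $X$ is ordered componentwise: $\vec x\leq_k\vec x'$ iff $x_i\le x'_i$ for all $i$. A feasibility function is a monotone $f:X\to\{\mathbf{true},\mathbf{false}\}$ (if $f(\vec x)=\mathbf{true}$ and $\vec x\leq_k\vec x'$ then $f(\vec x')=\mathbf{true}$). A Pareto point is $\vec x$ with $f(\vec x)=\mathbf{true}$ and $f(\vec x')=\mathbf{false}$ for all $\vec x'\ne\vec x$ with $\vec x'\leq_k\vec x$; the set of Pareto points is the Pareto front. A co-Pareto point is $\vec x$ with $f(\vec x)=\mathbf{false}$ and $f(\vec x')=\mathbf{true}$ for all $\vec x'\neq\vec x$ with $\vec x\leq_k\vec x'$; the set of co-Pareto points is the co-Pareto front. -}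

module Defs where

open import Data.Nat using (ℕ; suc)
open import Data.Fin using (Fin) renaming (_≤_ to _≤ᶠ_)
open import Data.Vec using (Vec; lookup)
open import Data.Bool using (Bool; true; false)
open import Data.List using (List; []; _∷_)
open import Data.List.Membership.Propositional using (_∈_)
open import Data.Product using (_×_)
open import Function.Bundles using (_⇔_)
open import Relation.Binary.PropositionalEquality using (_≡_; _≢_)

X : ℕ → ℕ → Set
X N k = Vec (Fin (suc N)) k

_≤ₖ_ : ∀ {N k} → X N k → X N k → Set
x ≤ₖ y = ∀ i → lookup x i ≤ᶠ lookup y i

Feasibility : ∀ {N k} → (X N k → Bool) → Set
Feasibility {N} {k} f = ∀ (x y : X N k) → f x ≡ true → x ≤ₖ y → f y ≡ true

IsPareto : ∀ {N k} → (X N k → Bool) → X N k → Set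
IsPareto {N} {k} f x = f x ≡ true × (∀ (y : X N k) → y ≢ x → y ≤ₖ x → f y ≡ false)

IsCoPareto : ∀ {N k} → (X N k → Bool) → X N k → Set
IsCoPareto {N} {k} f x = f x ≡ false × (∀ (y : X N k) → y ≢ x → x ≤ₖ y → f y ≡ true)

-- Deterministic oracle algorithms: (well-founded, hence terminating) decision
-- trees that query the oracle at a point and branch on the Boolean answer,
-- finally outputting a value of type A.
data Alg (Q A : Set) : Set where
  done  : A → Alg Q A
  query : Q → (Bool → Alg Q A) → Alg Q A

run : ∀ {Q A} → Alg Q A → (Q → Bool) → A
run (done a)    f = a
run (query q k) f = run (k (f q)) f

queries : ∀ {Q A} → Alg Q A → (Q → Bool) → List Q
queries (done a)    f = []
queries (query q k) f = q ∷ queries (k (f q)) f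

ComputesParetoFront : ∀ {N k} → Alg (X N k) (List (X N k)) → Set
ComputesParetoFront {N} {k} 𝒜 =
  ∀ (f : X N k → Bool) → Feasibility f →
    ∀ (x : X N k) → (x ∈ run 𝒜 f) ⇔ IsPareto f x

module Submission where

-- The argument is an indistinguishability (adversary) argument.  Let x be a
-- co-Pareto point of a feasibility function f, and let f⁺ = raise f x be the
-- function that agrees with f except that it is true at x.
--   * Since x is co-Pareto, f⁺ is still monotone, i.e. a feasibility function;
--     since f x is false, every point strictly below x is infeasible for f⁺, so
--     x is a Pareto point of f⁺ (but not of f).
--   * A deterministic oracle algorithm whose run on f never queries x cannot
--     tell f and f⁺ apart, so it produces the same output on both.
-- A correct algorithm must output x on f⁺ and must not output x on f, hence its
-- run on f queries x.

open import Defs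
open import Data.Nat using (ℕ; _≤_)
open import Data.Bool using (Bool; true; false; if_then_else_)
open import Data.List using (List)
open import Data.List.Membership.Propositional using (_∈_)
open import Data.List.Relation.Unary.Any using (here; there)
open import Data.Product using (_,_; proj₁)
open import Data.Sum using (_⊎_; inj₁; inj₂)
import Data.Fin.Properties as Fin
open import Data.Vec.Properties using (≡-dec)
open import Function.Bundles using (Equivalence)
open import Relation.Nullary using (does; yes; no)
open import Relation.Nullary.Decidable using (dec-true; dec-false)
open import Relation.Binary.Definitions using (DecidableEquality)
open import Relation.Binary.PropositionalEquality
  using (_≡_; _≢_; refl; sym; trans; cong; subst)
open import Data.Empty using (⊥-elim)
open import Data.Bool.Properties using (not-¬)

run-agrees-unless-queried : ∀ {Q A : Set} (𝒜 : Alg Q A) (f g : Q → Bool) (x : Q) →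
  (∀ q → x ≡ q ⊎ f q ≡ g q) →
  x ∈ queries 𝒜 f ⊎ run 𝒜 f ≡ run 𝒜 g
run-agrees-unless-queried (done a)    f g x agree = inj₂ refl
run-agrees-unless-queried (query q k) f g x agree with agree q
... | inj₁ x≡q  = inj₁ (here x≡q)
... | inj₂ fq≡gq with run-agrees-unless-queried (k (f q)) f g x agree
...   | inj₁ queried = inj₁ (there queried)
...   | inj₂ same    = inj₂ (trans same (cong (λ b → run (k b) g) fq≡gq))

module Raise {Q : Set} (_≟_ : DecidableEquality Q) (f : Q → Bool) (x : Q) where

  raise : Q → Bool
  raise q = if does (x ≟ q) then true else f q

  raise-at : raise x ≡ true
  raise-at rewrite dec-true (x ≟ x) refl = refl

  raise-off : ∀ {q} → x ≢ q → raise q ≡ f q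
  raise-off {q} x≢q rewrite dec-false (x ≟ q) x≢q = refl

  raise-agrees-off-x : ∀ q → x ≡ q ⊎ f q ≡ raise q
  raise-agrees-off-x q with x ≟ q
  ... | yes x≡q = inj₁ x≡q
  ... | no  _   = inj₂ refl

module _ {N k : ℕ} where

  _≟ₓ_ : DecidableEquality (X N k)
  _≟ₓ_ = ≡-dec Fin._≟_

  below-infeasible : ∀ {f : X N k → Bool} → Feasibility f →
    ∀ {x y} → f x ≡ false → y ≤ₖ x → f y ≡ false
  below-infeasible {f} feas {x} {y} fx≡false y≤x with f y in fy
  ... | false = refl
  ... | true  = trans (sym (feas y x fy y≤x)) fx≡false

  module _ (f : X N k → Bool) (feas : Feasibility f) (x : X N k) where
    open Raise _≟ₓ_ f x

    raise-feasible : IsCoPareto f x → Feasibility raise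
    raise-feasible (_ , above-feasible) y z raise-y y≤z with x ≟ₓ z
    ... | yes _   = refl
    ... | no  x≢z with x ≟ₓ y
    ...   | yes x≡y = above-feasible z (λ z≡x → x≢z (sym z≡x)) (subst (_≤ₖ z) (sym x≡y) y≤z)
    ...   | no  _   = feas y z raise-y y≤z

    raise-pareto : f x ≡ false → IsPareto raise x
    raise-pareto fx≡false = raise-at , λ y y≢x y≤x →
      trans (raise-off (λ x≡y → y≢x (sym x≡y))) (below-infeasible feas fx≡false y≤x)

-- Every correct Pareto-front algorithm queries every co-Pareto point
-- (the argument does not need the hypothesis 1 ≤ k).
lemma6 : (N k : ℕ) → 1 ≤ k →
    (𝒜 : Alg (X N k) (List (X N k))) → ComputesParetoFront 𝒜 →
    ∀ (f : X N k → Bool) → Feasibility f →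
      ∀ (x : X N k) → IsCoPareto f x → x ∈ queries 𝒜 f
lemma6 N k _ 𝒜 correct f feas x coPareto@(fx≡false , _)
  with run-agrees-unless-queried 𝒜 f raise x raise-agrees-off-x
  where open Raise _≟ₓ_ f x
... | inj₁ queried = queried
... | inj₂ same-output = ⊥-elim (not-¬ fx≡false fx≡true)
  where
  open Raise _≟ₓ_ f x
  x-output-on-raise : x ∈ run 𝒜 raise
  x-output-on-raise = Equivalence.from (correct raise (raise-feasible f feas x coPareto) x)
                                       (raise-pareto f feas x fx≡false)
  fx≡true : f x ≡ true
  fx≡true = proj₁ (Equivalence.to (correct f feas x)
                                  (subst (x ∈_) (sym same-output) x-output-on-raise))
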